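{- Let $S$ be a completely simple semigroup with $n$ minimal left ideals, and write $n=2p$ or $n=2p+1$ with $p$ a positive integer. Then the independence number of $\mathcal{I}n(S)$ is $\alpha(\mathcal{I}n(S))=\binom{n}{p}$.
   Context: A semigroup $S$ is completely simple if it has no proper two-sided ideal and contains a primitive idempotent (an idempotent $e$ minimal among idempotents under $e\le f\iff ef=fe=e$). A left ideal is a non-empty $I\subseteq S$ with $SI\subseteq I$; it is nontrivial if $I\neq S$ and minimal if it properly contains no left ideal. The inclusion ideal graph $\mathcal{I}n(S)$ is the simple undirected graph whose vertices are the nontrivial left ideals of $S$, with distinct $I,J$ adjacent iff $I\subset J$ or $J\subset I$. The independence number is the maximum size of a set of pairwise non-adjacent vertices. -}

module Defs where

open import Level using (Level; _⊔_)
open import Data.Nat using (ℕ; _≤_)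
open import Data.Fin using (Fin)
open import Data.Sum using (_⊎_)
open import Data.Product using (Σ; ∃; _×_; _,_)
open import Relation.Nullary using (¬_)
open import Relation.Binary.PropositionalEquality using (_≡_)
open import Relation.Binary.Definitions using (_Respects_)
open import Relation.Unary using (Pred; _⊆_; _⊂_; _≐_)
open import Algebra.Bundles using (Semigroup)

module _ {c ℓ : Level} (S : Semigroup c ℓ) where
  open Semigroup S

  Subset : Set _
  Subset = Pred Carrier (c ⊔ ℓ)

  IsLeftIdeal : Subset → Set (c ⊔ ℓ)
  IsLeftIdeal I = (∃ λ x → I x) × (∀ s x → I x → I (s ∙ x)) × (I Respects _≈_)

  IsIdeal : Subset → Set (c ⊔ ℓ)
  IsIdeal I = (∃ λ x → I x) × (∀ s x → I x → I (s ∙ x))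
            × (∀ s x → I x → I (x ∙ s)) × (I Respects _≈_)

  IsIdempotent : Carrier → Set ℓ
  IsIdempotent e = e ∙ e ≈ e

  _≤ᵢ_ : Carrier → Carrier → Set ℓ
  f ≤ᵢ e = (f ∙ e ≈ f) × (e ∙ f ≈ f)

  IsPrimitiveIdempotent : Carrier → Set (c ⊔ ℓ)
  IsPrimitiveIdempotent e = IsIdempotent e × (∀ f → IsIdempotent f → f ≤ᵢ e → f ≈ e)

  CompletelySimple : Set _
  CompletelySimple = (∀ (I : Subset) → IsIdeal I → ∀ x → I x)
                   × (∃ λ e → IsPrimitiveIdempotent e)

  IsMinimalLeftIdeal : Subset → Set _
  IsMinimalLeftIdeal L = IsLeftIdeal L × (∀ (J : Subset) → IsLeftIdeal J → ¬ (J ⊂ L))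

  HasMinimalLeftIdeals : ℕ → Set _
  HasMinimalLeftIdeals n = Σ (Fin n → Subset) λ L →
      (∀ i → IsMinimalLeftIdeal (L i))
    × (∀ i j → L i ≐ L j → i ≡ j)
    × (∀ (M : Subset) → IsMinimalLeftIdeal M → ∃ λ i → M ≐ L i)

  IsVertex : Subset → Set _
  IsVertex I = IsLeftIdeal I × ¬ (∀ x → I x)

  Adjacent : Subset → Subset → Set _
  Adjacent I J = (I ⊂ J) ⊎ (J ⊂ I)

  IndependentSet : ℕ → Set _
  IndependentSet k = Σ (Fin k → Subset) λ I →
      (∀ i → IsVertex (I i))
    × (∀ i j → I i ≐ I j → i ≡ j)
    × (∀ i j → ¬ (i ≡ j) → ¬ Adjacent (I i) (I j))

  IndependenceNumberIs : ℕ → Set _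
  IndependenceNumberIs m = IndependentSet m × (∀ k → IndependentSet k → k ≤ m)

module Submission where

open import Defs
open import Level using (Level)
open import Data.Nat using (ℕ; suc; _*_; _≤_)
open import Data.Nat.Combinatorics using (_C_)
open import Data.Sum using (_⊎_)
open import Relation.Binary.PropositionalEquality using (_≡_)
open import Algebra.Bundles using (Semigroup)

open import Data.Fin using (Fin; zero; suc; _≟_)
import Data.Fin.Subset as FS
open import Data.Fin.Subset using () renaming (Subset to FinSubset)
open import Data.List using (List; length)
import Data.List as List
open import Data.List.Membership.Propositional.Properties using (∈-lookup)
open import Data.List.Properties using (length-tabulate)
open import Data.List.Relation.Unary.All using (All)
import Data.List.Relation.Unary.All as All
import Data.List.Relation.Unary.AllPairs.Properties as AllPairs
open import Data.Nat using (zero; _+_; _<_; _≤?_)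
open import Data.Nat.Properties using (≤-refl; ≤-trans; n≤1+n; m≤n⇒m≤1+n; m<m+n; +-suc; +-identityʳ)
open import Data.Product using (∃; ∃₂; _×_; _,_; proj₁; proj₂; uncurry)
open import Data.Sum using (inj₁; inj₂)
open import Function using (_∘_)
open import Relation.Nullary using (¬_; Dec)
open import Relation.Nullary.Decidable using (decidable-stable; ¬¬-excluded-middle)
open import Relation.Nullary.Negation using (¬¬-map)
open import Relation.Binary.PropositionalEquality using (subst; cong)
import Relation.Binary.PropositionalEquality as ≡

-- Let e be a primitive idempotent. Since S e S = S, every element lies in a left ideal S(es), and a
-- left ideal I containing a = r(es) contains all of S(es): e = w(re) for some w, so es = wa ∈ I.
-- Hence the S(es) are the minimal left ideals L₁, …, Lₙ, they are pairwise disjoint, and every left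
-- ideal is the union of the Lᵢ it contains. So A ↦ ⋃_{i ∈ A} Lᵢ identifies the vertices of 𝓘n(S),
-- ordered by inclusion, with the nonempty proper subsets of {1, …, n}, and independent sets with
-- antichains. The bound is then Sperner's theorem, proved through the LYM inequality
-- Σ_{A ∈ F} |A|! (n − |A|)! ≤ n!, and the p-subsets form an antichain of size n C p.

module Antichains where

  open import Data.Empty using (⊥-elim)
  open import Data.Fin using (punchOut)
  open import Data.Fin.Properties using (all?; ¬∀⟶∃¬)
  open import Data.Fin.Subset hiding (Subset)
  open import Data.Fin.Subset.Properties
  open import Data.List using ([]; _∷_; _++_; map)
  import Data.List as List
  open import Data.List.Properties using (map-cong-local; length-map; length-++)
  open import Data.List.Relation.Unary.All using ([]; _∷_)
  import Data.List.Relation.Unary.All as All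
  import Data.List.Relation.Unary.All.Properties as All
  import Data.List.Relation.Unary.AllPairs as AllPairs
  import Data.List.Relation.Unary.AllPairs.Properties as AllPairs
  open import Data.List.Relation.Unary.AllPairs using (AllPairs; []; _∷_)
  open import Data.Nat using (_∸_; z≤n; s≤s; s≤s⁻¹; _!)
  open import Data.Nat.Combinatorics using (nCk+nC[k+1]≡[n+1]C[k+1]; nCk≡n!/k![n-k]!; k![n∸k]!∣n!)
  open import Data.Nat.DivMod using (m/n*n≡m)
  open import Data.Nat.ListAction using (sum)
  open import Data.Nat.Properties hiding (_≟_)
  open import Data.Product using (swap)
  open import Data.Vec using ([]; _∷_; removeAt; tabulate; here; there)
  open import Data.Vec.Properties using (removeAt-punchOut; []=⇒lookup; lookup⇒[]=; lookup∘tabulate)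
  open import Function using (case_of_)
  open import Relation.Nullary using (yes; no; does)
  open import Relation.Nullary.Decidable using (dec-true)
  open import Relation.Binary.PropositionalEquality
  open import Algebra.Properties.CommutativeMonoid.Sum +-0-commutativeMonoid
    using (sum-syntax; ∑-distrib-+; sum-cong-≗)
    renaming (sum to ∑)

  private variable
    n : ℕ

  Incomparable : FinSubset n → FinSubset n → Set
  Incomparable p q = p ⊈ q × q ⊈ p

  Antichain : List (FinSubset n) → Set
  Antichain = AllPairs Incomparable

  ⊤-or-missing : (p : FinSubset n) → p ≡ ⊤ ⊎ ∃ (_∉ p)
  ⊤-or-missing {n} p with all? (_∈? p)
  ... | yes all = inj₁ (⊆-antisym ⊆⊤ (λ {x} _ → all x))
  ... | no ¬all = inj₂ (¬∀⟶∃¬ n (_∈ p) (_∈? p) ¬all)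

  antichain-⊤-or-missing : {F : List (FinSubset n)} → Antichain F →
    F ≡ ⊤ ∷ [] ⊎ All (λ p → ∃ (_∉ p)) F
  antichain-⊤-or-missing [] = inj₂ []
  antichain-⊤-or-missing {F = p ∷ F} (p∥F ∷ ac) with ⊤-or-missing p | antichain-⊤-or-missing ac
  ... | inj₂ p-missing | inj₂ F-missing = inj₂ (p-missing ∷ F-missing)
  ... | inj₁ refl      | _ with F | p∥F
  ...   | []     | _              = inj₁ refl
  ...   | q ∷ _  | (_ , q⊈⊤) ∷ _ = ⊥-elim (q⊈⊤ ⊆⊤)
  antichain-⊤-or-missing (p∥F ∷ ac) | inj₂ _ | inj₁ refl = ⊥-elim (proj₁ (All.head p∥F) ⊆⊤)

  ∣removeAt∣ : ∀ (p : FinSubset (suc n)) {x} → x ∉ p → ∣ removeAt p x ∣ ≡ ∣ p ∣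
  ∣removeAt∣ (outside ∷ p) {zero} x∉p = refl
  ∣removeAt∣ (inside ∷ p) {zero} x∉p = ⊥-elim (x∉p here)
  ∣removeAt∣ (inside ∷ p@(_ ∷ _)) {suc x} x∉p = cong suc (∣removeAt∣ p (x∉p ∘ there))
  ∣removeAt∣ (outside ∷ p@(_ ∷ _)) {suc x} x∉p = ∣removeAt∣ p (x∉p ∘ there)

  removeAt-⊆⇒⊆ : ∀ {p q : FinSubset (suc n)} {x} → x ∉ p → removeAt p x ⊆ removeAt q x → p ⊆ q
  removeAt-⊆⇒⊆ {p = p} {q} {x} x∉p sub {i} i∈p with x ≟ i
  ... | yes refl = ⊥-elim (x∉p i∈p)
  ... | no x≢i = lookup⇒[]= i q (trans (sym (removeAt-punchOut q x≢i))
      ([]=⇒lookup (sub (lookup⇒[]= (punchOut x≢i) (removeAt p x)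
        (trans (removeAt-punchOut p x≢i) ([]=⇒lookup i∈p))))))

  ∑-const : ∀ m c → ∑[ i < m ] c ≡ m * c
  ∑-const zero    c = refl
  ∑-const (suc m) c = cong (c +_) (∑-const m c)

  ∑-mono-≤ : ∀ {m} {f g : Fin m → ℕ} → (∀ i → f i ≤ g i) → ∑ f ≤ ∑ g
  ∑-mono-≤ {zero}  f≤g = z≤n
  ∑-mono-≤ {suc m} f≤g = +-mono-≤ (f≤g zero) (∑-mono-≤ (f≤g ∘ suc))

  ∑-sum-comm : ∀ {m} {A : Set} (f : Fin m → A → ℕ) (xs : List A) →
    ∑[ i < m ] sum (map (f i) xs) ≡ sum (map (λ a → ∑[ i < m ] f i a) xs)
  ∑-sum-comm {m} f []       = trans (∑-const m 0) (*-zeroʳ m)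
  ∑-sum-comm     f (a ∷ xs) = trans (∑-distrib-+ (λ i → f i a) (λ i → sum (map (f i) xs)))
                                    (cong (∑[ i < _ ] f i a +_) (∑-sum-comm f xs))

  ∑-outside : ∀ (p : FinSubset n) (f : Fin n → ℕ) {c} →
    (∀ {x} → x ∈ p → f x ≡ 0) → (∀ {x} → x ∉ p → f x ≡ c) → ∑ f ≡ (n ∸ ∣ p ∣) * c
  ∑-outside []            f f∈ f∉ = refl
  ∑-outside (inside ∷ p)  f f∈ f∉ =
    cong₂ _+_ (f∈ here) (∑-outside p (f ∘ suc) (f∈ ∘ there) (λ x∉p → f∉ (x∉p ∘ drop-there)))
  ∑-outside {suc n} (outside ∷ p) f {c} f∈ f∉ = begin
    f zero + ∑ (f ∘ suc)  ≡⟨ cong₂ _+_ (f∉ λ ()) (∑-outside p (f ∘ suc) (f∈ ∘ there) (λ x∉p → f∉ (x∉p ∘ drop-there))) ⟩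
    c + (n ∸ ∣ p ∣) * c   ≡⟨ cong (_* c) (+-∸-assoc 1 (∣p∣≤n p)) ⟨
    (suc n ∸ ∣ p ∣) * c   ∎
    where open ≡-Reasoning

  weight : FinSubset n → ℕ
  weight {n} p = ∣ p ∣ ! * (n ∸ ∣ p ∣) !

  weight-⊤ : weight (⊤ {n}) ≡ n !
  weight-⊤ {n} rewrite ∣⊤∣≡n n | n∸n≡0 n = *-identityʳ (n !)

  deletedWeight : Fin (suc n) → FinSubset (suc n) → ℕ
  deletedWeight x p with x ∈? p
  ... | yes _ = 0
  ... | no  _ = weight (removeAt p x)

  weight-split : (p : FinSubset (suc n)) → ∃ (_∉ p) → weight p ≡ ∑[ x < suc n ] deletedWeight x p
  weight-split {n} p (y , y∉p) = sym (begin
    ∑[ x < suc n ] deletedWeight x p  ≡⟨ ∑-outside p _ inside⇒0 outside⇒w ⟩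
    (suc n ∸ a) * (a ! * (n ∸ a) !)   ≡⟨ cong (_* (a ! * (n ∸ a) !)) (+-∸-assoc 1 a≤n) ⟩
    suc (n ∸ a) * (a ! * (n ∸ a) !)   ≡⟨ x∙yz≈y∙xz (suc (n ∸ a)) (a !) ((n ∸ a) !) ⟩
    a ! * suc (n ∸ a) !               ≡⟨ cong (λ d → a ! * d !) (+-∸-assoc 1 a≤n) ⟨
    weight p                          ∎)
    where
    open ≡-Reasoning
    open import Algebra.Properties.CommutativeSemigroup *-commutativeSemigroup using (x∙yz≈y∙xz)
    a : ℕ
    a = ∣ p ∣
    a≤n : a ≤ n
    a≤n = s≤s⁻¹ (subst (a <_) (∣⊤∣≡n (suc n)) (p⊂q⇒∣p∣<∣q∣ (⊆⊤ , y , ∈⊤ , y∉p)))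
    inside⇒0 : ∀ {x} → x ∈ p → deletedWeight x p ≡ 0
    inside⇒0 {x} x∈p with x ∈? p
    ... | yes _   = refl
    ... | no x∉p = ⊥-elim (x∉p x∈p)
    outside⇒w : ∀ {x} → x ∉ p → deletedWeight x p ≡ a ! * (n ∸ a) !
    outside⇒w {x} x∉p with x ∈? p
    ... | yes x∈p = ⊥-elim (x∉p x∈p)
    ... | no  _   = cong (λ k → k ! * (n ∸ k) !) (∣removeAt∣ p x∉p)

  avoiding : Fin (suc n) → List (FinSubset (suc n)) → List (FinSubset n)
  avoiding x [] = []
  avoiding x (p ∷ F) with x ∈? p
  ... | yes _ = avoiding x F
  ... | no  _ = removeAt p x ∷ avoiding x F

  sum-deletedWeight : ∀ x (F : List (FinSubset (suc n))) →
    sum (map (deletedWeight x) F) ≡ sum (map weight (avoiding x F))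
  sum-deletedWeight x [] = refl
  sum-deletedWeight x (p ∷ F) with x ∈? p
  ... | yes _ = sum-deletedWeight x F
  ... | no  _ = cong (weight (removeAt p x) +_) (sum-deletedWeight x F)

  avoiding-All : ∀ x {P : FinSubset (suc n) → Set} {Q : FinSubset n → Set} →
    (∀ {p} → x ∉ p → P p → Q (removeAt p x)) → ∀ {F} → All P F → All Q (avoiding x F)
  avoiding-All x P⇒Q [] = []
  avoiding-All x P⇒Q {p ∷ F} (Pp ∷ PF) with x ∈? p
  ... | yes _   = avoiding-All x P⇒Q PF
  ... | no  x∉p = P⇒Q x∉p Pp ∷ avoiding-All x P⇒Q PF

  avoiding-antichain : ∀ x {F : List (FinSubset (suc n))} → Antichain F → Antichain (avoiding x F)
  avoiding-antichain x [] = []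
  avoiding-antichain x {p ∷ F} (p∥F ∷ ac) with x ∈? p
  ... | yes _   = avoiding-antichain x ac
  ... | no  x∉p =
    avoiding-All x (λ x∉q (p⊈q , q⊈p) → p⊈q ∘ removeAt-⊆⇒⊆ x∉p , q⊈p ∘ removeAt-⊆⇒⊆ x∉q) p∥F
    ∷ avoiding-antichain x ac

  mutual
    lym : (F : List (FinSubset n)) → Antichain F → sum (map weight F) ≤ n !
    lym {n} F ac with antichain-⊤-or-missing ac
    ... | inj₁ refl    = ≤-reflexive (trans (+-identityʳ _) (weight-⊤ {n}))
    ... | inj₂ missing = lym-missing F ac missing

    -- Counting each member of F once for every point it misses (weight-split) reduces the bound
    -- to the families avoiding x, which live one dimension lower.
    lym-missing : (F : List (FinSubset n)) → Antichain F → All (λ p → ∃ (_∉ p)) F →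
      sum (map weight F) ≤ n !
    lym-missing {zero}  []      _  _               = z≤n
    lym-missing {zero}  (_ ∷ _) _  ((() , _) ∷ _)
    lym-missing {suc n} F       ac missing = begin
      sum (map weight F)
        ≡⟨ cong sum (map-cong-local (All.map (weight-split _) missing)) ⟩
      sum (map (λ p → ∑[ x < suc n ] deletedWeight x p) F)
        ≡⟨ ∑-sum-comm deletedWeight F ⟨
      ∑[ x < suc n ] sum (map (deletedWeight x) F)
        ≡⟨ sum-cong-≗ (λ x → sum-deletedWeight x F) ⟩
      ∑[ x < suc n ] sum (map weight (avoiding x F))
        ≤⟨ ∑-mono-≤ (λ x → lym (avoiding x F) (avoiding-antichain x ac)) ⟩
      ∑[ x < suc n ] (n !)
        ≡⟨ ∑-const (suc n) (n !) ⟩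
      suc n * n !
        ∎
      where open ≤-Reasoning

  !*!-shift : ∀ {x y} → x ≤ y → suc x ! * y ! ≤ x ! * suc y !
  !*!-shift {x} {y} x≤y = begin
    (suc x * x !) * y ! ≡⟨ *-assoc (suc x) (x !) (y !) ⟩
    suc x * (x ! * y !) ≤⟨ *-monoˡ-≤ (x ! * y !) (s≤s x≤y) ⟩
    suc y * (x ! * y !) ≡⟨ x∙yz≈y∙xz (suc y) (x !) (y !) ⟩
    x ! * (suc y * y !) ∎
    where
    open ≤-Reasoning
    open import Algebra.Properties.CommutativeSemigroup *-commutativeSemigroup using (x∙yz≈y∙xz)

  !*!-shift⁺ : ∀ a d q → a + d ≤ suc q → (a + d) ! * q ! ≤ a ! * (q + d) !
  !*!-shift⁺ a zero    q _ rewrite +-identityʳ a | +-identityʳ q = ≤-refl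
  !*!-shift⁺ a (suc d) q a+d<q rewrite +-suc a d | +-suc q d =
    ≤-trans (!*!-shift (s≤s⁻¹ a+d<q)) (!*!-shift⁺ a d (suc q) (m≤n⇒m≤1+n (m≤n⇒m≤1+n (s≤s⁻¹ a+d<q))))

  !*!-≤-below : ∀ {p q a b} → a + b ≡ p + q → p ≤ suc q → a ≤ p → p ! * q ! ≤ a ! * b !
  !*!-≤-below {p} {q} {a} {b} a+b≡p+q p≤1+q a≤p =
    subst₂ (λ p′ b′ → p′ ! * q ! ≤ a ! * b′ !) a+d≡p q+d≡b
      (!*!-shift⁺ a d q (subst (_≤ suc q) (sym a+d≡p) p≤1+q))
    where
    open ≡-Reasoning
    open import Algebra.Properties.CommutativeSemigroup +-commutativeSemigroup using (x∙yz≈y∙xz)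
    d : ℕ
    d = p ∸ a
    a+d≡p : a + d ≡ p
    a+d≡p = m+[n∸m]≡n a≤p
    q+d≡b : q + d ≡ b
    q+d≡b = +-cancelˡ-≡ a _ _ (begin
      a + (q + d) ≡⟨ x∙yz≈y∙xz a q d ⟩
      q + (a + d) ≡⟨ cong (q +_) a+d≡p ⟩
      q + p       ≡⟨ +-comm q p ⟩
      p + q       ≡⟨ a+b≡p+q ⟨
      a + b       ∎)

  !*!-balanced-≤ : ∀ {p q a b} → a + b ≡ p + q → p ≤ suc q → q ≤ suc p → p ! * q ! ≤ a ! * b !
  !*!-balanced-≤ {p} {q} {a} {b} a+b≡p+q p≤1+q q≤1+p with ≤-total a p
  ... | inj₁ a≤p = !*!-≤-below a+b≡p+q p≤1+q a≤p
  ... | inj₂ p≤a = subst₂ _≤_ (*-comm (q !) (p !)) (*-comm (b !) (a !))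
    (!*!-≤-below (trans (+-comm b a) (trans a+b≡p+q (+-comm p q))) q≤1+p b≤q)
    where
    b≤q : b ≤ q
    b≤q = +-cancelˡ-≤ p b q (≤-trans (+-monoˡ-≤ b p≤a) (≤-reflexive a+b≡p+q))

  C*!*!≡! : ∀ {n p} → p ≤ n → (n C p) * (p ! * (n ∸ p) !) ≡ n !
  C*!*!≡! {n} {p} p≤n = trans (cong (_* (p ! * (n ∸ p) !)) (nCk≡n!/k![n-k]! p≤n))
    (m/n*n≡m {{p !* (n ∸ p) !≢0}} (k![n∸k]!∣n! p≤n))

  sperner : ∀ {n} p q → p + q ≡ n → p ≤ suc q → q ≤ suc p →
    (F : List (FinSubset n)) → Antichain F → length F ≤ n C p
  sperner {n} p q p+q≡n p≤1+q q≤1+p F ac =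
    *-cancelʳ-≤ (length F) (n C p) (p ! * q !) {{p !* q !≢0}} (begin
      length F * (p ! * q !)
        ≤⟨ length*min≤sum weight (λ a → !*!-balanced-≤ {a = ∣ a ∣} (∣a∣+rest≡p+q a) p≤1+q q≤1+p) F ⟩
      sum (map weight F)           ≤⟨ lym F ac ⟩
      n !                          ≡⟨ C*!*!≡! p≤n ⟨
      (n C p) * (p ! * (n ∸ p) !)  ≡⟨ cong (λ r → (n C p) * (p ! * r !)) n∸p≡q ⟩
      (n C p) * (p ! * q !)        ∎)
    where
    open ≤-Reasoning
    p≤n : p ≤ n
    p≤n = subst (p ≤_) p+q≡n (m≤m+n p q)
    n∸p≡q : n ∸ p ≡ q
    n∸p≡q = trans (cong (_∸ p) (sym p+q≡n)) (m+n∸m≡n p q)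
    ∣a∣+rest≡p+q : ∀ (a : FinSubset n) → ∣ a ∣ + (n ∸ ∣ a ∣) ≡ p + q
    ∣a∣+rest≡p+q a = trans (m+[n∸m]≡n (∣p∣≤n a)) (sym p+q≡n)
    length*min≤sum : ∀ {A : Set} (f : A → ℕ) {c} → (∀ a → c ≤ f a) →
      ∀ xs → length xs * c ≤ sum (map f xs)
    length*min≤sum f c≤f []       = z≤n
    length*min≤sum f c≤f (x ∷ xs) = +-mono-≤ (c≤f x) (length*min≤sum f c≤f xs)

  subsetsOfSize : (n k : ℕ) → List (FinSubset n)
  subsetsOfSize zero    zero    = [] ∷ []
  subsetsOfSize zero    (suc k) = []
  subsetsOfSize (suc n) zero    = map (outside ∷_) (subsetsOfSize n zero)
  subsetsOfSize (suc n) (suc k) =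
    map (outside ∷_) (subsetsOfSize n (suc k)) ++ map (inside ∷_) (subsetsOfSize n k)

  length-subsetsOfSize : ∀ n k → length (subsetsOfSize n k) ≡ n C k
  length-subsetsOfSize zero    zero    = refl
  length-subsetsOfSize zero    (suc k) = refl
  length-subsetsOfSize (suc n) zero    =
    trans (length-map _ (subsetsOfSize n zero)) (length-subsetsOfSize n zero)
  length-subsetsOfSize (suc n) (suc k) = begin
    length (map (outside ∷_) (subsetsOfSize n (suc k)) ++ map (inside ∷_) (subsetsOfSize n k))
      ≡⟨ length-++ (map (outside ∷_) (subsetsOfSize n (suc k))) ⟩
    length (map (outside ∷_) (subsetsOfSize n (suc k))) + length (map (inside ∷_) (subsetsOfSize n k))
      ≡⟨ cong₂ _+_ (length-map _ (subsetsOfSize n (suc k))) (length-map _ (subsetsOfSize n k)) ⟩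
    length (subsetsOfSize n (suc k)) + length (subsetsOfSize n k)
      ≡⟨ cong₂ _+_ (length-subsetsOfSize n (suc k)) (length-subsetsOfSize n k) ⟩
    n C suc k + n C k
      ≡⟨ +-comm (n C suc k) (n C k) ⟩
    n C k + n C suc k
      ≡⟨ nCk+nC[k+1]≡[n+1]C[k+1] n k ⟩
    suc n C suc k ∎
    where open ≡-Reasoning

  subsetsOfSize-size : ∀ n k → All (λ p → ∣ p ∣ ≡ k) (subsetsOfSize n k)
  subsetsOfSize-size zero    zero    = refl ∷ []
  subsetsOfSize-size zero    (suc k) = []
  subsetsOfSize-size (suc n) zero    = All.map⁺ (subsetsOfSize-size n zero)
  subsetsOfSize-size (suc n) (suc k) = All.++⁺ (All.map⁺ (subsetsOfSize-size n (suc k)))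
                                               (All.map⁺ (All.map (cong suc) (subsetsOfSize-size n k)))

  ∷-incomparable : ∀ {p q : FinSubset n} s → Incomparable p q → Incomparable (s ∷ p) (s ∷ q)
  ∷-incomparable s (p⊈q , q⊈p) = p⊈q ∘ drop-∷-⊆ , q⊈p ∘ drop-∷-⊆

  incomparable-by-size : ∀ {p q : FinSubset n} {k} → ∣ p ∣ ≡ suc k → ∣ q ∣ ≡ k →
    Incomparable (outside ∷ p) (inside ∷ q)
  incomparable-by-size ∣p∣≡1+k ∣q∣≡k =
    (λ p⊆q → 1+n≰n (subst₂ _≤_ ∣p∣≡1+k ∣q∣≡k (p⊆q⇒∣p∣≤∣q∣ (drop-∷-⊆ p⊆q))))
    , (λ q⊆p → case q⊆p here of λ ())

  subsetsOfSize-antichain : ∀ n k → Antichain (subsetsOfSize n k)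
  subsetsOfSize-antichain zero    zero    = [] ∷ []
  subsetsOfSize-antichain zero    (suc k) = []
  subsetsOfSize-antichain (suc n) zero    =
    AllPairs.map⁺ (AllPairs.map (∷-incomparable outside) (subsetsOfSize-antichain n zero))
  subsetsOfSize-antichain (suc n) (suc k) = AllPairs.++⁺
    (AllPairs.map⁺ (AllPairs.map (∷-incomparable outside) (subsetsOfSize-antichain n (suc k))))
    (AllPairs.map⁺ (AllPairs.map (∷-incomparable inside) (subsetsOfSize-antichain n k)))
    (All.map⁺ (All.map
      (λ ∣p∣≡1+k → All.map⁺ (All.map (incomparable-by-size ∣p∣≡1+k) (subsetsOfSize-size n k)))
      (subsetsOfSize-size n (suc k))))

  antichain-lookup : ∀ {F : List (FinSubset n)} → Antichain F → ∀ {i j} → i ≢ j →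
    Incomparable (List.lookup F i) (List.lookup F j)
  antichain-lookup (p∥F ∷ _)  {zero}  {zero}  i≢j = ⊥-elim (i≢j refl)
  antichain-lookup (p∥F ∷ _)  {zero}  {suc j} _   = All.lookup p∥F (∈-lookup j)
  antichain-lookup (p∥F ∷ _)  {suc i} {zero}  _   = swap (All.lookup p∥F (∈-lookup i))
  antichain-lookup (_ ∷ ac)   {suc i} {suc j} i≢j = antichain-lookup ac (i≢j ∘ cong suc)

  nonempty-of-size : (p : FinSubset n) → 0 < ∣ p ∣ → Nonempty p
  nonempty-of-size {n} p 0<∣p∣ with nonempty? p
  ... | yes p≠∅ = p≠∅
  ... | no  p≡∅ = ⊥-elim (<⇒≢ 0<∣p∣ (sym (trans (cong ∣_∣ (Empty-unique p≡∅)) (∣⊥∣≡0 n))))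

  missing-of-size : (p : FinSubset n) → ∣ p ∣ < n → ∃ (_∉ p)
  missing-of-size {n} p ∣p∣<n with ⊤-or-missing p
  ... | inj₁ refl    = ⊥-elim (<⇒≢ ∣p∣<n (∣⊤∣≡n n))
  ... | inj₂ missing = missing

  subsetsOfSize-nontrivial : ∀ n k → 0 < k → k < n →
    All (λ p → Nonempty p × ∃ (_∉ p)) (subsetsOfSize n k)
  subsetsOfSize-nontrivial n k 0<k k<n = All.map
    (λ {p} ∣p∣≡k → nonempty-of-size p (subst (0 <_) (sym ∣p∣≡k) 0<k)
                 , missing-of-size p (subst (_< n) (sym ∣p∣≡k) k<n))
    (subsetsOfSize-size n k)

  decidedSubset : ∀ {p} {P : Fin n → Set p} → (∀ i → Dec (P i)) → FinSubset n
  decidedSubset P? = tabulate (does ∘ P?)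

  ∈-decidedSubset⁺ : ∀ {p} {P : Fin n → Set p} (P? : ∀ i → Dec (P i)) {i} →
    P i → i ∈ decidedSubset P?
  ∈-decidedSubset⁺ P? {i} Pi = lookup⇒[]= i _ (trans (lookup∘tabulate _ i) (dec-true (P? i) Pi))

  ∈-decidedSubset⁻ : ∀ {p} {P : Fin n → Set p} (P? : ∀ i → Dec (P i)) {i} →
    i ∈ decidedSubset P? → P i
  ∈-decidedSubset⁻ P? {i} i∈ with P? i | trans (sym (lookup∘tabulate (does ∘ P?) i)) ([]=⇒lookup i∈)
  ... | yes Pi | _  = Pi
  ... | no  _  | ()

open Antichains

¬¬-∀-Fin : ∀ {p} m {P : Fin m → Set p} → (∀ i → ¬ ¬ P i) → ¬ ¬ (∀ i → P i)
¬¬-∀-Fin zero    ¬¬P ¬∀P = ¬∀P λ ()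
¬¬-∀-Fin (suc m) ¬¬P ¬∀P =
  ¬¬P zero λ P₀ → ¬¬-∀-Fin m (¬¬P ∘ suc) λ P₊ → ¬∀P λ { zero → P₀ ; (suc i) → P₊ i }

module MinimalLeftIdeals {c ℓ : Level} (S : Semigroup c ℓ) where
  open import Relation.Unary using (_⊆_; _≐_)
  open Semigroup S
  open import Relation.Binary.Reasoning.Setoid setoid

  -- ((e y) e) x is an idempotent below e, so primitivity forces it to equal e.
  e≈xy⇒e≈[eye]x : ∀ {e x y} → IsPrimitiveIdempotent S e → x ∙ e ≈ x → e ≈ x ∙ y →
    e ≈ ((e ∙ y) ∙ e) ∙ x
  e≈xy⇒e≈[eye]x {e} {x} {y} (ee≈e , e-minimal) xe≈x e≈xy = sym (e-minimal g gg≈g (ge≈g , eg≈g))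
    where
    w g : Carrier
    w = (e ∙ y) ∙ e
    g = w ∙ x
    xw≈e : x ∙ w ≈ e
    xw≈e = begin
      x ∙ ((e ∙ y) ∙ e) ≈⟨ assoc x (e ∙ y) e ⟨
      (x ∙ (e ∙ y)) ∙ e ≈⟨ ∙-congʳ (assoc x e y) ⟨
      ((x ∙ e) ∙ y) ∙ e ≈⟨ ∙-congʳ (∙-congʳ xe≈x) ⟩
      (x ∙ y) ∙ e       ≈⟨ ∙-congʳ e≈xy ⟨
      e ∙ e             ≈⟨ ee≈e ⟩
      e                 ∎
    gg≈g : g ∙ g ≈ g
    gg≈g = begin
      (w ∙ x) ∙ (w ∙ x) ≈⟨ assoc w x (w ∙ x) ⟩
      w ∙ (x ∙ (w ∙ x)) ≈⟨ ∙-congˡ (assoc x w x) ⟨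
      w ∙ ((x ∙ w) ∙ x) ≈⟨ ∙-congˡ (∙-congʳ xw≈e) ⟩
      w ∙ (e ∙ x)       ≈⟨ assoc w e x ⟨
      (w ∙ e) ∙ x       ≈⟨ ∙-congʳ (trans (assoc (e ∙ y) e e) (∙-congˡ ee≈e)) ⟩
      w ∙ x             ∎
    ge≈g : g ∙ e ≈ g
    ge≈g = trans (assoc w x e) (∙-congˡ xe≈x)
    eg≈g : e ∙ g ≈ g
    eg≈g = begin
      e ∙ (((e ∙ y) ∙ e) ∙ x) ≈⟨ assoc e w x ⟨
      (e ∙ ((e ∙ y) ∙ e)) ∙ x ≈⟨ ∙-congʳ (assoc e (e ∙ y) e) ⟨
      ((e ∙ (e ∙ y)) ∙ e) ∙ x ≈⟨ ∙-congʳ (∙-congʳ (assoc e e y)) ⟨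
      (((e ∙ e) ∙ y) ∙ e) ∙ x ≈⟨ ∙-congʳ (∙-congʳ (∙-congʳ ee≈e)) ⟩
      g                       ∎

  S·_ : Carrier → Subset S
  (S· a) y = ∃ λ r → y ≈ r ∙ a

  S·_·S : Carrier → Subset S
  (S· b ·S) y = ∃₂ λ u v → y ≈ u ∙ (b ∙ v)

  S·-isLeftIdeal : ∀ a → IsLeftIdeal S (S· a)
  S·-isLeftIdeal a = (a ∙ a , a , refl)
    , (λ { s y (r , y≈ra) → s ∙ r , trans (∙-congˡ y≈ra) (sym (assoc s r a)) })
    , λ { y≈z (r , y≈ra) → r , trans (sym y≈z) y≈ra }

  S·-·S-isIdeal : ∀ b → IsIdeal S (S· b ·S)
  S·-·S-isIdeal b = (b ∙ (b ∙ b) , b , b , refl)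
    , (λ { s y (u , v , y≈ubv) → s ∙ u , v , trans (∙-congˡ y≈ubv) (sym (assoc s u (b ∙ v))) })
    , (λ { s y (u , v , y≈ubv) → u , v ∙ s ,
           trans (∙-congʳ y≈ubv) (trans (assoc u (b ∙ v) s) (∙-congˡ (assoc b v s))) })
    , λ { y≈z (u , v , y≈ubv) → u , v , trans (sym y≈z) y≈ubv }

  module _ (simple : ∀ I → IsIdeal S I → ∀ x → I x) {e} (e-prim : IsPrimitiveIdempotent S e) where

    e∈S·x : ∀ {x} → x ∙ e ≈ x → (S· x) e
    e∈S·x {x} xe≈x with simple (S· x ·S) (S·-·S-isIdeal x) e
    ... | u , v , e≈u[xv] = ((e ∙ v) ∙ e) ∙ u , (begin
      e                          ≈⟨ e≈xy⇒e≈[eye]x e-prim (trans (assoc u x e) (∙-congˡ xe≈x))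
                                                         (trans e≈u[xv] (sym (assoc u x v))) ⟩
      ((e ∙ v) ∙ e) ∙ (u ∙ x)    ≈⟨ assoc ((e ∙ v) ∙ e) u x ⟨
      (((e ∙ v) ∙ e) ∙ u) ∙ x    ∎)

    ∈S·es : ∀ x → ∃ λ s → (S· (e ∙ s)) x
    ∈S·es x with simple (S· e ·S) (S·-·S-isIdeal e) x
    ... | u , s , x≈u[es] = s , u , x≈u[es]

    S·es-⊆ : ∀ {I s a} → IsLeftIdeal S I → I a → (S· (e ∙ s)) a → S· (e ∙ s) ⊆ I
    S·es-⊆ {I} {s} {a} (_ , I-closed , I-resp) Ia (r , a≈r[es]) {y} (r′ , y≈r′[es]) =
      I-resp (sym y≈r′w∙a) (I-closed (r′ ∙ w) a Ia)
      where
      e∈S·re : (S· (r ∙ e)) e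
      e∈S·re = e∈S·x (trans (assoc r e e) (∙-congˡ (proj₁ e-prim)))
      w : Carrier
      w = proj₁ e∈S·re
      es≈wa : e ∙ s ≈ w ∙ a
      es≈wa = begin
        e ∙ s              ≈⟨ ∙-congʳ (proj₂ e∈S·re) ⟩
        (w ∙ (r ∙ e)) ∙ s  ≈⟨ assoc w (r ∙ e) s ⟩
        w ∙ ((r ∙ e) ∙ s)  ≈⟨ ∙-congˡ (assoc r e s) ⟩
        w ∙ (r ∙ (e ∙ s))  ≈⟨ ∙-congˡ a≈r[es] ⟨
        w ∙ a              ∎
      y≈r′w∙a : y ≈ (r′ ∙ w) ∙ a
      y≈r′w∙a = trans y≈r′[es] (trans (∙-congˡ es≈wa) (sym (assoc r′ w a)))

    S·es-isMinimal : ∀ s → IsMinimalLeftIdeal S (S· (e ∙ s))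
    S·es-isMinimal s = S·-isLeftIdeal (e ∙ s) ,
      λ { J J-left@((a , Ja) , _) (J⊆S·es , S·es⊈J) → S·es⊈J (S·es-⊆ J-left Ja (J⊆S·es Ja)) }

    module _ {n : ℕ} (L : Fin n → Subset S) (L-minimal : ∀ i → IsMinimalLeftIdeal S (L i))
             (L-injective : ∀ i j → L i ≐ L j → i ≡ j) where

      minimal-disjoint : ∀ {i j x} → L i x → L j x → i ≡ j
      minimal-disjoint {i} {j} {x} x∈Li x∈Lj with ∈S·es x
      ... | s , x∈M = decidable-stable (i ≟ j) λ i≢j →
        proj₂ (L-minimal i) M M-left (M⊆ i x∈Li , λ Li⊆M →
        proj₂ (L-minimal j) M M-left (M⊆ j x∈Lj , λ Lj⊆M →
        i≢j (L-injective i j ((λ y → M⊆ j x∈Lj (Li⊆M y)) , λ y → M⊆ i x∈Li (Lj⊆M y)))))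
        where
        M : Subset S
        M = S· (e ∙ s)
        M-left : IsLeftIdeal S M
        M-left = S·-isLeftIdeal (e ∙ s)
        M⊆ : ∀ k → L k x → M ⊆ L k
        M⊆ k x∈Lk = S·es-⊆ (proj₁ (L-minimal k)) x∈Lk x∈M

      unionOf : FinSubset n → Subset S
      unionOf A y = ∃ λ i → i FS.∈ A × L i y

      unionOf-isVertex : ∀ {A} → FS.Nonempty A → ∃ (FS._∉ A) → IsVertex S (unionOf A)
      unionOf-isVertex {A} (i , i∈A) (j , j∉A) = (ideal-nonempty , closed , respects) , j-missing
        where
        ideal-nonempty : ∃ (unionOf A)
        ideal-nonempty = let (x , x∈Li) = proj₁ (proj₁ (L-minimal i)) in x , i , i∈A , x∈Li
        closed : ∀ s y → unionOf A y → unionOf A (s ∙ y)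
        closed s y (k , k∈A , y∈Lk) = k , k∈A , proj₁ (proj₂ (proj₁ (L-minimal k))) s y y∈Lk
        respects : ∀ {y z} → y ≈ z → unionOf A y → unionOf A z
        respects y≈z (k , k∈A , y∈Lk) = k , k∈A , proj₂ (proj₂ (proj₁ (L-minimal k))) y≈z y∈Lk
        j-missing : ¬ (∀ y → unionOf A y)
        j-missing all with proj₁ (proj₁ (L-minimal j))
        ... | x , x∈Lj with all x
        ...   | k , k∈A , x∈Lk = j∉A (subst (FS._∈ A) (minimal-disjoint x∈Lk x∈Lj) k∈A)

      unionOf-⊆⇒⊆ : ∀ {A B} → unionOf A ⊆ unionOf B → A FS.⊆ B
      unionOf-⊆⇒⊆ {A} {B} sub {i} i∈A with proj₁ (proj₁ (L-minimal i))
      ... | x , x∈Li with sub (i , i∈A , x∈Li)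
      ...   | j , j∈B , x∈Lj = subst (FS._∈ B) (minimal-disjoint x∈Lj x∈Li) j∈B

      antichain⇒independentSet : (F : List (FinSubset n)) → Antichain F →
        All (λ A → FS.Nonempty A × ∃ (FS._∉ A)) F → IndependentSet S (length F)
      antichain⇒independentSet F ac nontrivial = I , vertex , injective , independent
        where
        I : Fin (length F) → Subset S
        I i = unionOf (List.lookup F i)
        vertex : ∀ i → IsVertex S (I i)
        vertex i = uncurry unionOf-isVertex (All.lookup nontrivial (∈-lookup i))
        injective : ∀ i j → I i ≐ I j → i ≡ j
        injective i j (Ii⊆Ij , _) =
          decidable-stable (i ≟ j) λ i≢j → proj₁ (antichain-lookup ac i≢j) (unionOf-⊆⇒⊆ Ii⊆Ij)
        independent : ∀ i j → ¬ i ≡ j → ¬ Adjacent S (I i) (I j)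
        independent i j i≢j (inj₁ (Ii⊆Ij , _)) = proj₁ (antichain-lookup ac i≢j) (unionOf-⊆⇒⊆ Ii⊆Ij)
        independent i j i≢j (inj₂ (Ij⊆Ii , _)) = proj₂ (antichain-lookup ac i≢j) (unionOf-⊆⇒⊆ Ij⊆Ii)

      module _ (L-complete : ∀ M → IsMinimalLeftIdeal S M → ∃ λ i → M ≐ L i) where

        leftIdeal-⊇-minimal : ∀ {I x} → IsLeftIdeal S I → I x → ∃ λ i → L i x × L i ⊆ I
        leftIdeal-⊇-minimal I-left x∈I with ∈S·es _
        ... | s , x∈M with L-complete _ (S·es-isMinimal s)
        ...   | i , M⊆Li , Li⊆M = i , M⊆Li x∈M , λ y∈Li → S·es-⊆ I-left x∈I x∈M (Li⊆M y∈Li)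

        support : (I : Subset S) → (∀ i → Dec (L i ⊆ I)) → FinSubset n
        support I L⊆I? = decidedSubset L⊆I?

        support-⊆⇒⊆ : ∀ {I J} (L⊆I? : ∀ i → Dec (L i ⊆ I)) (L⊆J? : ∀ i → Dec (L i ⊆ J)) →
          IsLeftIdeal S I → support I L⊆I? FS.⊆ support J L⊆J? → I ⊆ J
        support-⊆⇒⊆ L⊆I? L⊆J? I-left sub x∈I with leftIdeal-⊇-minimal I-left x∈I
        ... | i , x∈Li , Li⊆I = ∈-decidedSubset⁻ L⊆J? (sub (∈-decidedSubset⁺ L⊆I? Li⊆I)) x∈Li

        -- Lᵢ ⊆ I is not decidable, so the antichain of supports only exists under ¬ ¬; this is
        -- enough because the bound k ≤ n C p is decidable.
        independentSet⇒antichain : ∀ {k} → IndependentSet S k →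
          ¬ ¬ (∃ λ F → length F ≡ k × Antichain F)
        independentSet⇒antichain {k} (I , vertex , injective , independent) =
          ¬¬-map antichain (¬¬-∀-Fin k λ j → ¬¬-∀-Fin n λ i → ¬¬-excluded-middle)
          where
          antichain : (∀ j i → Dec (L i ⊆ I j)) → ∃ λ F → length F ≡ k × Antichain F
          antichain L⊆I? = List.tabulate A , length-tabulate A ,
            AllPairs.tabulate⁺ λ j≢j′ → A-⊈ j≢j′ , A-⊈ (j≢j′ ∘ ≡.sym)
            where
            A : Fin k → FinSubset n
            A j = support (I j) (L⊆I? j)
            A-⊈ : ∀ {j j′} → ¬ j ≡ j′ → ¬ (A j FS.⊆ A j′)
            A-⊈ {j} {j′} j≢j′ Aj⊆Aj′ = independent j j′ j≢j′
              (inj₁ (Ij⊆Ij′ , λ Ij′⊆Ij → j≢j′ (injective j j′ (Ij⊆Ij′ , Ij′⊆Ij))))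
              where
              Ij⊆Ij′ : I j ⊆ I j′
              Ij⊆Ij′ = support-⊆⇒⊆ (L⊆I? j) (L⊆I? j′) (proj₁ (vertex j)) Aj⊆Aj′

balancedSplit : ∀ {n p} → n ≡ 2 * p ⊎ n ≡ suc (2 * p) → ∃ λ q → p + q ≡ n × p ≤ q × q ≤ suc p
balancedSplit {p = p} (inj₁ n≡2p) =
  p , ≡.trans (cong (p +_) (≡.sym (+-identityʳ p))) (≡.sym n≡2p) , ≤-refl , n≤1+n p
balancedSplit {p = p} (inj₂ n≡2p+1) =
  suc p , ≡.trans (+-suc p p) (≡.trans (cong (λ m → suc (p + m)) (≡.sym (+-identityʳ p))) (≡.sym n≡2p+1))
  , n≤1+n p , ≤-refl

mainTheorem9 : {c ℓ : Level} (S : Semigroup c ℓ) (n p : ℕ) →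
    1 ≤ p → (n ≡ 2 * p ⊎ n ≡ suc (2 * p)) →
    CompletelySimple S → HasMinimalLeftIdeals S n →
    IndependenceNumberIs S (n C p)
mainTheorem9 S n p 1≤p n≡2p⊎2p+1 (simple , e , e-prim) (L , L-minimal , L-injective , L-complete)
  with balancedSplit n≡2p⊎2p+1
... | q , p+q≡n , p≤q , q≤1+p = lower , upper
  where
  open MinimalLeftIdeals S
  p<n : p < n
  p<n = subst (p <_) p+q≡n (m<m+n p (≤-trans 1≤p p≤q))
  lower : IndependentSet S (n C p)
  lower = subst (IndependentSet S) (length-subsetsOfSize n p)
    (antichain⇒independentSet simple e-prim L L-minimal L-injective (subsetsOfSize n p)
      (subsetsOfSize-antichain n p) (subsetsOfSize-nontrivial n p 1≤p p<n))
  upper : ∀ k → IndependentSet S k → k ≤ n C p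
  upper k I = decidable-stable (k ≤? n C p) (¬¬-map
    (λ { (F , ≡.refl , ac) → sperner p q p+q≡n (m≤n⇒m≤1+n p≤q) q≤1+p F ac })
    (independentSet⇒antichain simple e-prim L L-minimal L-injective L-complete I))
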